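{- For all sets of sentences $\Phi, \Psi \subseteq \mathrm{FO}$, the following are equivalent: (1) $\Phi \models_\mathcal{L} \Psi$ for all lattice semirings $\mathcal{L}$ not isomorphic to $\mathbb{B}$; (2) $\Phi \models_\mathcal{L} \Psi$ for some lattice semiring $\mathcal{L}$ not isomorphic to $\mathbb{B}$; (3) $\pi[\![\Psi]\!] = 1$ for all $\mathcal{S}_3$-interpretations $\pi$ with $\pi[\![\Phi]\!] = 1$.
   Context: Semiring semantics: for a commutative, naturally ordered semiring $\mathcal{S}=(S,+,\cdot,0,1)$, an $\mathcal{S}$-interpretation $\pi$ over a universe $A$ maps every instantiated literal $R\bar a$ or $\neg R\bar a$ to a value in $S$; it is model-defining if for every literal $L$ exactly one of $\pi(L),\pi(\neg L)$ is $0$; only model-defining interpretations are considered. Formulae in negation normal form are evaluated inductively (disjunction by $+$, conjunction by $\cdot$, $\exists$ by sum over the universe, $\forall$ by product over the universe, equalities Boolean); for a set $\Phi$, $\pi[\![\Phi]\!]=\prod_{\varphi\in\Phi}\pi[\![\varphi]\!]$. $\Phi\models_{\mathcal{S}}\Psi$ means $\pi[\![\Phi]\!]\le\pi[\![\Psi]\!]$ (natural order) for every model-defining $\mathcal{S}$-interpretation $\pi$. A lattice semiring is $(S,\sqcup,\sqcap,0,1)$ induced by a completely distributive complete lattice (closed under arbitrary suprema and infima, infima distributing over suprema), with supremum as addition and infimum as multiplication; $\mathbb{B}=(\{0,1\},\vee,\wedge,0,1)$ is the Boolean semiring, and $\mathcal{S}_3=(\{0,\epsilon,1\},\max,\min,0,1)$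 with $0<\epsilon<1$ is the three-element min-max semiring. -}

module Defs where

open import Data.Nat using (ℕ; suc)
open import Data.Fin using (Fin)
open import Data.Vec using (Vec; []; _∷_; lookup; map)
open import Data.Bool using (Bool; true; false; _∨_; _∧_; if_then_else_)
open import Data.Empty using (⊥)
open import Data.Product using (Σ; ∃; _×_; _,_; proj₁)
open import Data.Sum using (_⊎_)
open import Relation.Nullary using (¬_; Dec; yes; no; does)
open import Relation.Binary.PropositionalEquality using (_≡_; _≢_)
open import Relation.Binary.Definitions using (DecidableEquality)

record Signature : Set₁ where
  field
    Rel   : Set
    arity : Rel → ℕ
open Signature public

data Formula (σ : Signature) (n : ℕ) : Set where
  eq neq     : Fin n → Fin n → Formula σ n
  pos neg    : (R : Rel σ) → Vec (Fin n) (arity σ R) → Formula σ n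
  or and     : Formula σ n → Formula σ n → Formula σ n
  ex all     : Formula σ (suc n) → Formula σ n

Sentence : Signature → Set
Sentence σ = Formula σ 0

SentenceSet : Signature → Set₁
SentenceSet σ = Sentence σ → Set

record EvalOps : Set₁ where
  field
    Carrier : Set
    _⊕_ _⊗_ : Carrier → Carrier → Carrier
    𝟘 𝟙     : Carrier
    ⨁ ⨂     : (I : Set) → (I → Carrier) → Carrier

NatLeq : (S : EvalOps) → EvalOps.Carrier S → EvalOps.Carrier S → Set
NatLeq S a b = ∃ λ c → EvalOps._⊕_ S a c ≡ b

-- a universe: a nonempty set (with decidable equality, used for the
-- Boolean evaluation of equality literals)
record Universe : Set₁ where
  field
    U    : Set
    _≟_  : DecidableEquality U
    pt   : U
open Universe public

record Interp (σ : Signature) (S : EvalOps) (A : Universe) : Set where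
  field
    πpos : (R : Rel σ) → Vec (U A) (arity σ R) → EvalOps.Carrier S
    πneg : (R : Rel σ) → Vec (U A) (arity σ R) → EvalOps.Carrier S
open Interp public

ModelDefining : {σ : Signature} {S : EvalOps} {A : Universe} → Interp σ S A → Set
ModelDefining {σ} {S} π = ∀ (R : Rel σ) ā →
    (πpos π R ā ≡ 𝟘 × πneg π R ā ≢ 𝟘) ⊎ (πpos π R ā ≢ 𝟘 × πneg π R ā ≡ 𝟘)
  where open EvalOps S

module _ {σ : Signature} {S : EvalOps} {A : Universe} (π : Interp σ S A) where
  open EvalOps S

  eval : {n : ℕ} → Vec (U A) n → Formula σ n → Carrier
  eval ρ (eq i j)  = if does ((A ≟ lookup ρ i) (lookup ρ j)) then 𝟙 else 𝟘
  eval ρ (neq i j) = if does ((A ≟ lookup ρ i) (lookup ρ j)) then 𝟘 else 𝟙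
  eval ρ (pos R xs) = πpos π R (map (lookup ρ) xs)
  eval ρ (neg R xs) = πneg π R (map (lookup ρ) xs)
  eval ρ (or φ ψ)  = eval ρ φ ⊕ eval ρ ψ
  eval ρ (and φ ψ) = eval ρ φ ⊗ eval ρ ψ
  eval ρ (ex φ)    = ⨁ (U A) (λ a → eval (a ∷ ρ) φ)
  eval ρ (all φ)   = ⨂ (U A) (λ a → eval (a ∷ ρ) φ)

  evalSet : SentenceSet σ → Carrier
  evalSet Φ = ⨂ (Σ (Sentence σ) Φ) (λ p → eval [] (proj₁ p))

Entails : {σ : Signature} → EvalOps → SentenceSet σ → SentenceSet σ → Set₁
Entails {σ} S Φ Ψ = ∀ (A : Universe) (π : Interp σ S A) → ModelDefining π →
  NatLeq S (evalSet π Φ) (evalSet π Ψ)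

record LatticeSemiring : Set₁ where
  field
    Carrier : Set
    _⊑_     : Carrier → Carrier → Set
    ⊑-refl  : ∀ {a} → a ⊑ a
    ⊑-trans : ∀ {a b c} → a ⊑ b → b ⊑ c → a ⊑ c
    ⊑-antisym : ∀ {a b} → a ⊑ b → b ⊑ a → a ≡ b
    ⋁ ⋀     : (I : Set) → (I → Carrier) → Carrier
    ⋁-upper : ∀ I (f : I → Carrier) i → f i ⊑ ⋁ I f
    ⋁-least : ∀ I (f : I → Carrier) b → (∀ i → f i ⊑ b) → ⋁ I f ⊑ b
    ⋀-lower : ∀ I (f : I → Carrier) i → ⋀ I f ⊑ f i
    ⋀-greatest : ∀ I (f : I → Carrier) b → (∀ i → b ⊑ f i) → b ⊑ ⋀ I f
    distrib : ∀ (I : Set) (J : I → Set) (x : (i : I) → J i → Carrier) →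
      ⋀ I (λ i → ⋁ (J i) (x i)) ≡ ⋁ ((i : I) → J i) (λ f → ⋀ I (λ i → x i (f i)))
    nontrivial : ⋁ ⊥ (λ ()) ≢ ⋀ ⊥ (λ ())

  _⊔_ _⊓_ : Carrier → Carrier → Carrier
  a ⊔ b = ⋁ Bool (λ t → if t then a else b)
  a ⊓ b = ⋀ Bool (λ t → if t then a else b)

  bot top : Carrier
  bot = ⋁ ⊥ (λ ())
  top = ⋀ ⊥ (λ ())

  ops : EvalOps
  ops = record { Carrier = Carrier ; _⊕_ = _⊔_ ; _⊗_ = _⊓_ ; 𝟘 = bot ; 𝟙 = top
               ; ⨁ = ⋁ ; ⨂ = ⋀ }

IsoToBool : LatticeSemiring → Set
IsoToBool L = Σ (Carrier → Bool) λ f → Σ (Bool → Carrier) λ g →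
    (∀ b → f (g b) ≡ b) × (∀ a → g (f a) ≡ a)
  × (∀ a b → f (a ⊔ b) ≡ (f a ∨ f b)) × (∀ a b → f (a ⊓ b) ≡ (f a ∧ f b))
  × (f bot ≡ false) × (f top ≡ true)
  where open LatticeSemiring L

-- Infinitary max/min over arbitrary index sets need classical logic,
-- so they are defined from an (informative) excluded-middle oracle.

data S3 : Set where
  s0 sε s1 : S3

max₃ min₃ : S3 → S3 → S3
max₃ s0 b = b
max₃ sε s0 = sε
max₃ sε sε = sε
max₃ sε s1 = s1
max₃ s1 _ = s1
min₃ s0 _ = s0
min₃ sε s0 = s0
min₃ sε sε = sε
min₃ sε s1 = sε
min₃ s1 b = b

ExcludedMiddle : Set₁
ExcludedMiddle = (P : Set) → Dec P

module _ (lem : ExcludedMiddle) where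
  sup₃ : (I : Set) → (I → S3) → S3
  sup₃ I f with lem (∃ λ i → f i ≡ s1)
  ... | yes _ = s1
  ... | no _ with lem (∃ λ i → f i ≡ sε)
  ...   | yes _ = sε
  ...   | no _  = s0

  inf₃ : (I : Set) → (I → S3) → S3
  inf₃ I f with lem (∃ λ i → f i ≡ s0)
  ... | yes _ = s0
  ... | no _ with lem (∃ λ i → f i ≡ sε)
  ...   | yes _ = sε
  ...   | no _  = s1

  S₃ : EvalOps
  S₃ = record { Carrier = S3 ; _⊕_ = max₃ ; _⊗_ = min₃ ; 𝟘 = s0 ; 𝟙 = s1
              ; ⨁ = sup₃ ; ⨂ = inf₃ }

-- (3) ⇒ (1): in a completely distributive lattice every element a is the join
-- of the elements totally below it (x ≪ a: every subset whose join is above a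
-- has a member above x), and ≪ interpolates. For x ≪ π⟦Φ⟧ consider the
-- threshold 𝒮₃-interpretation sending a literal value c to 0 if c = 0, to 1 if
-- x ≤ c, and to ε otherwise. It is model-defining, gives 1 to every formula
-- whose value lies above some y with x ≪ y, and gives 1 only to formulae whose
-- value lies above x; so (3) yields x ≤ π⟦Ψ⟧, hence π⟦Φ⟧ ≤ π⟦Ψ⟧.
-- (2) ⇒ (3): a lattice not isomorphic to 𝔹 has an element e ∉ {0, 1}, and
-- 0 ↦ 0, ε ↦ e, 1 ↦ 1 embeds 𝒮₃ into it preserving all suprema and infima,
-- hence the values of formulae.
-- (1) ⇒ (2): 𝒮₃ is itself a lattice semiring not isomorphic to 𝔹.

module Submission where

open import Defs
open import Data.Product using (Σ; _×_)
open import Relation.Nullary using (¬_)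
open import Relation.Binary.PropositionalEquality using (_≡_)

open import Data.Bool using (Bool; true; false; T; _∨_; _∧_; if_then_else_)
open import Data.Empty using (⊥; ⊥-elim)
open import Data.Product using (∃; _,_; proj₁; proj₂)
open import Data.Sum using (_⊎_; inj₁; inj₂)
open import Data.Unit using (⊤; tt)
open import Data.Vec using (Vec; []; _∷_; lookup)
open import Relation.Nullary using (yes; no; does)
open import Relation.Nullary.Decidable using (isYes; toWitness; fromWitness; dec-true; dec-false)
open import Relation.Binary.PropositionalEquality using (_≢_; refl; sym; trans; subst; cong)

data _≤₃_ : S3 → S3 → Set where
  s0≤   : ∀ {a} → s0 ≤₃ a
  ≤s1   : ∀ {a} → a ≤₃ s1
  sε≤sε : sε ≤₃ sε

≤₃-refl : ∀ {a} → a ≤₃ a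
≤₃-refl {s0} = s0≤
≤₃-refl {sε} = sε≤sε
≤₃-refl {s1} = ≤s1

≤₃-trans : ∀ {a b c} → a ≤₃ b → b ≤₃ c → a ≤₃ c
≤₃-trans s0≤   _     = s0≤
≤₃-trans _     ≤s1   = ≤s1
≤₃-trans sε≤sε sε≤sε = sε≤sε

≤₃-antisym : ∀ {a b} → a ≤₃ b → b ≤₃ a → a ≡ b
≤₃-antisym s0≤   s0≤   = refl
≤₃-antisym ≤s1   ≤s1   = refl
≤₃-antisym sε≤sε _     = refl

s1≤⇒≡s1 : ∀ {a} → s1 ≤₃ a → a ≡ s1
s1≤⇒≡s1 ≤s1 = refl

≤s0⇒≡s0 : ∀ {a} → a ≤₃ s0 → a ≡ s0
≤s0⇒≡s0 s0≤ = refl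

≢s1⇒≤sε : ∀ a → a ≢ s1 → a ≤₃ sε
≢s1⇒≤sε s0 _    = s0≤
≢s1⇒≤sε sε _    = sε≤sε
≢s1⇒≤sε s1 a≢s1 = ⊥-elim (a≢s1 refl)

≢s1,sε⇒≤s0 : ∀ a → a ≢ s1 → a ≢ sε → a ≤₃ s0
≢s1,sε⇒≤s0 s0 _    _    = s0≤
≢s1,sε⇒≤s0 sε _    a≢sε = ⊥-elim (a≢sε refl)
≢s1,sε⇒≤s0 s1 a≢s1 _    = ⊥-elim (a≢s1 refl)

≢s0⇒sε≤ : ∀ a → a ≢ s0 → sε ≤₃ a
≢s0⇒sε≤ s0 a≢s0 = ⊥-elim (a≢s0 refl)
≢s0⇒sε≤ sε _    = sε≤sε
≢s0⇒sε≤ s1 _    = ≤s1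

≢s0,sε⇒s1≤ : ∀ a → a ≢ s0 → a ≢ sε → s1 ≤₃ a
≢s0,sε⇒s1≤ s0 a≢s0 _    = ⊥-elim (a≢s0 refl)
≢s0,sε⇒s1≤ sε _    a≢sε = ⊥-elim (a≢sε refl)
≢s0,sε⇒s1≤ s1 _    _    = ≤s1

≤₃-fromNonzero : ∀ {a b} → (∀ v → v ≢ s0 → v ≤₃ a → v ≤₃ b) → a ≤₃ b
≤₃-fromNonzero {s0} _ = s0≤
≤₃-fromNonzero {sε} h = h sε (λ ()) sε≤sε
≤₃-fromNonzero {s1} h = h s1 (λ ()) ≤s1

-- Suprema and infima in the finite chain S3 are attained, except for the
-- empty family, whose supremum is s0 and whose infimum is s1.

AttainedSup : {I : Set} → (I → S3) → S3 → Set
AttainedSup {I} f s = (∀ i → f i ≤₃ s) × (s ≡ s0 ⊎ Σ I (λ i → f i ≡ s))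

AttainedInf : {I : Set} → (I → S3) → S3 → Set
AttainedInf {I} f s = (∀ i → s ≤₃ f i) × (s ≡ s1 ⊎ Σ I (λ i → f i ≡ s))

module _ {I : Set} {f : I → S3} {s : S3} where

  attainedSup-least : AttainedSup f s → ∀ {b} → (∀ i → f i ≤₃ b) → s ≤₃ b
  attainedSup-least (_ , inj₁ refl)       _  = s0≤
  attainedSup-least (_ , inj₂ (i , refl)) ub = ub i

  attainedSup-below : AttainedSup f s → ∀ {v} → v ≢ s0 → v ≤₃ s → Σ I (λ i → v ≤₃ f i)
  attainedSup-below (_ , inj₁ refl)       v≢s0 v≤s = ⊥-elim (v≢s0 (≤s0⇒≡s0 v≤s))
  attainedSup-below (_ , inj₂ (i , refl)) _    v≤s = i , v≤s

  attainedSup-≡s1 : AttainedSup f s → s ≡ s1 → Σ I (λ i → f i ≡ s1)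
  attainedSup-≡s1 sup refl with attainedSup-below sup (λ ()) ≤s1
  ... | i , s1≤fi = i , s1≤⇒≡s1 s1≤fi

  attainedSup-s1 : AttainedSup f s → ∀ i → f i ≡ s1 → s ≡ s1
  attainedSup-s1 (ub , _) i fi≡s1 = s1≤⇒≡s1 (subst (_≤₃ s) fi≡s1 (ub i))

  attainedInf-greatest : AttainedInf f s → ∀ {b} → (∀ i → b ≤₃ f i) → b ≤₃ s
  attainedInf-greatest (_ , inj₁ refl)       _  = ≤s1
  attainedInf-greatest (_ , inj₂ (i , refl)) lb = lb i

  attainedInf-≡s1 : AttainedInf f s → s ≡ s1 → ∀ i → f i ≡ s1
  attainedInf-≡s1 (lb , _) refl i = s1≤⇒≡s1 (lb i)

  attainedInf-s1 : AttainedInf f s → (∀ i → f i ≡ s1) → s ≡ s1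
  attainedInf-s1 (_ , inj₁ s≡s1)       _    = s≡s1
  attainedInf-s1 (_ , inj₂ (i , refl)) all1 = all1 i

module _ {a b : S3} where

  attainedSup-left : b ≤₃ a → AttainedSup (λ t → if t then a else b) a
  attainedSup-left b≤a = (λ { true → ≤₃-refl ; false → b≤a }) , inj₂ (true , refl)

  attainedSup-right : a ≤₃ b → AttainedSup (λ t → if t then a else b) b
  attainedSup-right a≤b = (λ { true → a≤b ; false → ≤₃-refl }) , inj₂ (false , refl)

  attainedInf-left : a ≤₃ b → AttainedInf (λ t → if t then a else b) a
  attainedInf-left a≤b = (λ { true → ≤₃-refl ; false → a≤b }) , inj₂ (true , refl)

  attainedInf-right : b ≤₃ a → AttainedInf (λ t → if t then a else b) b
  attainedInf-right b≤a = (λ { true → b≤a ; false → ≤₃-refl }) , inj₂ (false , refl)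

max₃-attained : ∀ a b → AttainedSup (λ t → if t then a else b) (max₃ a b)
max₃-attained s0 b  = attainedSup-right s0≤
max₃-attained sε s0 = attainedSup-left s0≤
max₃-attained sε sε = attainedSup-left sε≤sε
max₃-attained sε s1 = attainedSup-right ≤s1
max₃-attained s1 b  = attainedSup-left ≤s1

min₃-attained : ∀ a b → AttainedInf (λ t → if t then a else b) (min₃ a b)
min₃-attained s0 b  = attainedInf-left s0≤
min₃-attained sε s0 = attainedInf-right s0≤
min₃-attained sε sε = attainedInf-left sε≤sε
min₃-attained sε s1 = attainedInf-left ≤s1
min₃-attained s1 b  = attainedInf-right ≤s1

isoToBool-injective : ∀ L (iso : IsoToBool L) {a b : LatticeSemiring.Carrier L} →
  proj₁ iso a ≡ proj₁ iso b → a ≡ b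
isoToBool-injective L (f , g , _ , gf , _) {a} {b} fa≡fb =
  trans (sym (gf a)) (trans (cong g fa≡fb) (gf b))

bool-pigeonhole : ∀ (b₀ b₁ b₂ : Bool) → b₀ ≡ b₁ ⊎ b₀ ≡ b₂ ⊎ b₁ ≡ b₂
bool-pigeonhole false false _     = inj₁ refl
bool-pigeonhole true  true  _     = inj₁ refl
bool-pigeonhole false true  false = inj₂ (inj₁ refl)
bool-pigeonhole true  false true  = inj₂ (inj₁ refl)
bool-pigeonhole false true  true  = inj₂ (inj₂ refl)
bool-pigeonhole true  false false = inj₂ (inj₂ refl)

module S₃Lattice (lem : ExcludedMiddle) where

  sup₃-attained : ∀ I (f : I → S3) → AttainedSup f (sup₃ lem I f)
  sup₃-attained I f with lem (∃ λ i → f i ≡ s1)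
  ... | yes (i , fi≡s1) = (λ _ → ≤s1) , inj₂ (i , fi≡s1)
  ... | no ¬1 with lem (∃ λ i → f i ≡ sε)
  ...   | yes (i , fi≡sε) = (λ j → ≢s1⇒≤sε (f j) (λ e → ¬1 (j , e))) , inj₂ (i , fi≡sε)
  ...   | no ¬ε = (λ j → ≢s1,sε⇒≤s0 (f j) (λ e → ¬1 (j , e)) (λ e → ¬ε (j , e))) , inj₁ refl

  inf₃-attained : ∀ I (f : I → S3) → AttainedInf f (inf₃ lem I f)
  inf₃-attained I f with lem (∃ λ i → f i ≡ s0)
  ... | yes (i , fi≡s0) = (λ _ → s0≤) , inj₂ (i , fi≡s0)
  ... | no ¬0 with lem (∃ λ i → f i ≡ sε)
  ...   | yes (i , fi≡sε) = (λ j → ≢s0⇒sε≤ (f j) (λ e → ¬0 (j , e))) , inj₂ (i , fi≡sε)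
  ...   | no ¬ε = (λ j → ≢s0,sε⇒s1≤ (f j) (λ e → ¬0 (j , e)) (λ e → ¬ε (j , e))) , inj₁ refl

  sup₃-upper : ∀ I (f : I → S3) i → f i ≤₃ sup₃ lem I f
  sup₃-upper I f = proj₁ (sup₃-attained I f)

  inf₃-lower : ∀ I (f : I → S3) i → inf₃ lem I f ≤₃ f i
  inf₃-lower I f = proj₁ (inf₃-attained I f)

  sup₃-least : ∀ I (f : I → S3) b → (∀ i → f i ≤₃ b) → sup₃ lem I f ≤₃ b
  sup₃-least I f _ = attainedSup-least (sup₃-attained I f)

  inf₃-greatest : ∀ I (f : I → S3) b → (∀ i → b ≤₃ f i) → b ≤₃ inf₃ lem I f
  inf₃-greatest I f _ = attainedInf-greatest (inf₃-attained I f)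

  -- A nonzero lower bound of the infimum picks, in every J i, an index
  -- where it stays below; these choices form one term of the right side.
  inf₃-sup₃-distrib : ∀ (I : Set) (J : I → Set) (x : (i : I) → J i → S3) →
    inf₃ lem I (λ i → sup₃ lem (J i) (x i))
      ≡ sup₃ lem ((i : I) → J i) (λ g → inf₃ lem I (λ i → x i (g i)))
  inf₃-sup₃-distrib I J x = ≤₃-antisym lhs≤rhs rhs≤lhs
    where
    lhs rhs : S3
    lhs = inf₃ lem I (λ i → sup₃ lem (J i) (x i))
    rhs = sup₃ lem ((i : I) → J i) (λ g → inf₃ lem I (λ i → x i (g i)))

    lhs≤rhs : lhs ≤₃ rhs
    lhs≤rhs = ≤₃-fromNonzero λ v v≢s0 v≤lhs →
      let choice : ∀ i → Σ (J i) (λ j → v ≤₃ x i j)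
          choice i = attainedSup-below (sup₃-attained (J i) (x i)) v≢s0
                                       (≤₃-trans v≤lhs (inf₃-lower I _ i))
      in ≤₃-trans (inf₃-greatest I _ v (λ i → proj₂ (choice i)))
                  (sup₃-upper _ _ (λ i → proj₁ (choice i)))

    rhs≤lhs : rhs ≤₃ lhs
    rhs≤lhs = sup₃-least _ _ lhs (λ g → inf₃-greatest I _ _ (λ i →
                ≤₃-trans (inf₃-lower I _ i) (sup₃-upper (J i) (x i) (g i))))

  sup₃-empty≢inf₃-empty : ∀ (f g : ⊥ → S3) → sup₃ lem ⊥ f ≢ inf₃ lem ⊥ g
  sup₃-empty≢inf₃-empty f g sup≡inf
    with ≤s0⇒≡s0 (sup₃-least ⊥ f s0 (λ ())) | s1≤⇒≡s1 (inf₃-greatest ⊥ g s1 (λ ()))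
  ... | sup≡s0 | inf≡s1 with trans (sym sup≡s0) (trans sup≡inf inf≡s1)
  ... | ()

  L₃ : LatticeSemiring
  L₃ = record
    { Carrier = S3 ; _⊑_ = _≤₃_
    ; ⊑-refl = ≤₃-refl ; ⊑-trans = ≤₃-trans ; ⊑-antisym = ≤₃-antisym
    ; ⋁ = sup₃ lem ; ⋀ = inf₃ lem
    ; ⋁-upper = sup₃-upper ; ⋁-least = sup₃-least
    ; ⋀-lower = inf₃-lower ; ⋀-greatest = inf₃-greatest
    ; distrib = inf₃-sup₃-distrib
    ; nontrivial = sup₃-empty≢inf₃-empty _ _
    }

  L₃-¬IsoToBool : ¬ IsoToBool L₃
  L₃-¬IsoToBool iso@(f , _) with bool-pigeonhole (f s0) (f sε) (f s1)
  ... | inj₁ f0≡fε with isoToBool-injective L₃ iso f0≡fε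
  ...   | ()
  L₃-¬IsoToBool iso@(f , _) | inj₂ (inj₁ f0≡f1) with isoToBool-injective L₃ iso f0≡f1
  ...   | ()
  L₃-¬IsoToBool iso@(f , _) | inj₂ (inj₂ fε≡f1) with isoToBool-injective L₃ iso fε≡f1
  ...   | ()

module LatticeProperties (L : LatticeSemiring) where
  open LatticeSemiring L

  bot-least : ∀ x → bot ⊑ x
  bot-least x = ⋁-least ⊥ (λ ()) x (λ ())

  top-greatest : ∀ x → x ⊑ top
  top-greatest x = ⋀-greatest ⊥ (λ ()) x (λ ())

  x⊑y⇒x⊔y≡y : ∀ {x y} → x ⊑ y → x ⊔ y ≡ y
  x⊑y⇒x⊔y≡y {y = y} x⊑y =
    ⊑-antisym (⋁-least Bool _ y (λ { true → x⊑y ; false → ⊑-refl })) (⋁-upper Bool _ false)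

  ⊔-identityˡ : ∀ x → bot ⊔ x ≡ x
  ⊔-identityˡ x = x⊑y⇒x⊔y≡y (bot-least x)

  ⊔-zeroˡ : ∀ x → top ⊔ x ≡ top
  ⊔-zeroˡ x = ⊑-antisym (top-greatest _) (⋁-upper Bool _ true)

  ⊓-identityˡ : ∀ x → top ⊓ x ≡ x
  ⊓-identityˡ x =
    ⊑-antisym (⋀-lower Bool _ false) (⋀-greatest Bool _ x (λ { true → top-greatest x ; false → ⊑-refl }))

  ⊓-zeroˡ : ∀ x → bot ⊓ x ≡ bot
  ⊓-zeroˡ x = ⊑-antisym (⋀-lower Bool _ true) (bot-least _)

  ⊑⇒natLeq : ∀ {x y} → x ⊑ y → NatLeq ops x y
  ⊑⇒natLeq {y = y} x⊑y = y , x⊑y⇒x⊔y≡y x⊑y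

  natLeq-top : ∀ {y} → NatLeq ops top y → y ≡ top
  natLeq-top (z , top⊔z≡y) = trans (sym top⊔z≡y) (⊔-zeroˡ z)

  twoValued⇒IsoToBool : ExcludedMiddle → (∀ x → x ≡ bot ⊎ x ≡ top) → IsoToBool L
  twoValued⇒IsoToBool lem twoValued = f , g , fg , gf , f-⊔ , f-⊓ , f-bot , f-top
    where
    f : Carrier → Bool
    f x = does (lem (x ≡ top))
    g : Bool → Carrier
    g b = if b then top else bot
    f-top : f top ≡ true
    f-top = dec-true (lem _) refl
    f-bot : f bot ≡ false
    f-bot = dec-false (lem _) nontrivial
    fg : ∀ b → f (g b) ≡ b
    fg true  = f-top
    fg false = f-bot
    gf : ∀ x → g (f x) ≡ x
    gf x with twoValued x
    ... | inj₁ refl rewrite f-bot = refl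
    ... | inj₂ refl rewrite f-top = refl
    f-⊔ : ∀ x y → f (x ⊔ y) ≡ (f x ∨ f y)
    f-⊔ x y with twoValued x
    ... | inj₁ refl rewrite ⊔-identityˡ y | f-bot = refl
    ... | inj₂ refl rewrite ⊔-zeroˡ y | f-top = refl
    f-⊓ : ∀ x y → f (x ⊓ y) ≡ (f x ∧ f y)
    f-⊓ x y with twoValued x
    ... | inj₁ refl rewrite ⊓-zeroˡ y | f-bot = refl
    ... | inj₂ refl rewrite ⊓-identityˡ y | f-top = refl

  ¬IsoToBool⇒thirdElement : ExcludedMiddle → ¬ IsoToBool L → Σ Carrier (λ e → e ≢ bot × e ≢ top)
  ¬IsoToBool⇒thirdElement lem ¬iso with lem (Σ Carrier (λ e → e ≢ bot × e ≢ top))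
  ... | yes third = third
  ... | no ¬third = ⊥-elim (¬iso (twoValued⇒IsoToBool lem twoValued))
    where
    twoValued : ∀ x → x ≡ bot ⊎ x ≡ top
    twoValued x with lem (x ≡ bot) | lem (x ≡ top)
    ... | yes x≡bot | _         = inj₁ x≡bot
    ... | no _      | yes x≡top = inj₂ x≡top
    ... | no x≢bot  | no x≢top  = ⊥-elim (¬third (x , x≢bot , x≢top))

module TotallyBelow (lem : ExcludedMiddle) (L : LatticeSemiring) where
  open LatticeSemiring L

  -- Subsets are Bool-valued so that the covers of an element form a small
  -- index set, over which `approximant` takes an infimum.
  Subset : Set
  Subset = Carrier → Bool

  Member : Subset → Set
  Member S = Σ Carrier (λ c → T (S c))

  _≪_ : Carrier → Carrier → Set
  x ≪ a = (S : Subset) → a ⊑ ⋁ (Member S) proj₁ → Σ (Member S) (λ c → x ⊑ proj₁ c)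

  ≪-family : ∀ {x a I} {f : I → Carrier} → x ≪ a → a ⊑ ⋁ I f → Σ I (λ i → x ⊑ f i)
  ≪-family {x} {a} {I} {f} x≪a a⊑⋁f with x≪a image a⊑⋁image
    where
    image : Subset
    image c = isYes (lem (Σ I (λ i → f i ≡ c)))
    a⊑⋁image : a ⊑ ⋁ (Member image) proj₁
    a⊑⋁image = ⊑-trans a⊑⋁f (⋁-least I f _ (λ i → ⋁-upper _ proj₁ (f i , fromWitness (i , refl))))
  ... | (c , c∈image) , x⊑c with toWitness c∈image
  ...   | i , refl = i , x⊑c

  ⊑-≪-trans : ∀ {x y a} → x ⊑ y → y ≪ a → x ≪ a
  ⊑-≪-trans x⊑y y≪a S a⊑⋁S with y≪a S a⊑⋁S
  ... | c , y⊑c = c , ⊑-trans x⊑y y⊑c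

  ≪⇒⊑ : ∀ {x a} → x ≪ a → x ⊑ a
  ≪⇒⊑ {a = a} x≪a = proj₂ (≪-family x≪a (⋁-upper ⊤ (λ _ → a) tt))

  ≪⇒⋢bot : ∀ {x a} → x ≪ a → ¬ (a ⊑ bot)
  ≪⇒⋢bot x≪a a⊑bot = proj₁ (≪-family x≪a a⊑bot)

  Cover : Carrier → Set
  Cover a = Σ Subset (λ S → a ⊑ ⋁ (Member S) proj₁)

  Choice : Carrier → Set
  Choice a = (k : Cover a) → Member (proj₁ k)

  approximant : (a : Carrier) → Choice a → Carrier
  approximant a φ = ⋀ (Cover a) (λ k → proj₁ (φ k))

  approximant-≪ : ∀ a φ → approximant a φ ≪ a
  approximant-≪ a φ S a⊑⋁S = φ (S , a⊑⋁S) , ⋀-lower _ _ (S , a⊑⋁S)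

  ⊑-⋁approximant : ∀ a → a ⊑ ⋁ (Choice a) (approximant a)
  ⊑-⋁approximant a = subst (a ⊑_) (distrib (Cover a) (λ k → Member (proj₁ k)) (λ _ → proj₁))
                                  (⋀-greatest (Cover a) _ a proj₂)

  ≪-interpolate : ∀ {x a} → x ≪ a → Σ Carrier (λ y → x ≪ y × y ≪ a)
  ≪-interpolate {x} {a} x≪a with ≪-family x≪a a⊑⋁approximants
    where
    Approximants : Set
    Approximants = Σ (Choice a) (λ φ → Choice (approximant a φ))
    a⊑⋁approximants : a ⊑ ⋁ Approximants (λ (φ , ψ) → approximant (approximant a φ) ψ)
    a⊑⋁approximants = ⊑-trans (⊑-⋁approximant a) (⋁-least _ _ _ (λ φ →
      ⊑-trans (⊑-⋁approximant (approximant a φ)) (⋁-least _ _ _ (λ ψ → ⋁-upper _ _ (φ , ψ)))))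
  ... | (φ , ψ) , x⊑ = approximant a φ
                     , ⊑-≪-trans x⊑ (approximant-≪ (approximant a φ) ψ)
                     , approximant-≪ a φ

module Threshold (lem : ExcludedMiddle) (L : LatticeSemiring) (x : LatticeSemiring.Carrier L) where
  open LatticeSemiring L
  open LatticeProperties L
  open TotallyBelow lem L
  open S₃Lattice lem

  threshold : Carrier → S3
  threshold c with lem (c ≡ bot) | lem (x ⊑ c)
  ... | yes _ | _     = s0
  ... | no _  | yes _ = s1
  ... | no _  | no _  = sε

  threshold-≡s0 : ∀ c → threshold c ≡ s0 → c ≡ bot
  threshold-≡s0 c _ with lem (c ≡ bot) | lem (x ⊑ c)
  threshold-≡s0 c _  | yes c≡bot | _     = c≡bot
  threshold-≡s0 c () | no _      | yes _
  threshold-≡s0 c () | no _      | no _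

  threshold-bot : ∀ c → c ≡ bot → threshold c ≡ s0
  threshold-bot c c≡bot with lem (c ≡ bot) | lem (x ⊑ c)
  ... | yes _    | _ = refl
  ... | no c≢bot | _ = ⊥-elim (c≢bot c≡bot)

  threshold-≡s1 : ∀ c → threshold c ≡ s1 → x ⊑ c
  threshold-≡s1 c _ with lem (c ≡ bot) | lem (x ⊑ c)
  threshold-≡s1 c () | yes _ | _
  threshold-≡s1 c _  | no _  | yes x⊑c = x⊑c
  threshold-≡s1 c () | no _  | no _

  threshold-s1 : ∀ c → c ≢ bot → x ⊑ c → threshold c ≡ s1
  threshold-s1 c c≢bot x⊑c with lem (c ≡ bot) | lem (x ⊑ c)
  ... | yes c≡bot | _     = ⊥-elim (c≢bot c≡bot)
  ... | no _      | yes _ = refl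
  ... | no _      | no x⋢c = ⊥-elim (x⋢c x⊑c)

  module _ {σ : Signature} {A : Universe} (π : Interp σ ops A) where

    thresholdInterp : Interp σ (S₃ lem) A
    thresholdInterp = record { πpos = λ R ā → threshold (πpos π R ā)
                             ; πneg = λ R ā → threshold (πneg π R ā) }

    thresholdInterp-modelDefining : ModelDefining π → ModelDefining thresholdInterp
    thresholdInterp-modelDefining md R ā with md R ā
    ... | inj₁ (p≡0 , n≢0) = inj₁ (threshold-bot _ p≡0 , λ e → n≢0 (threshold-≡s0 _ e))
    ... | inj₂ (p≢0 , n≡0) = inj₂ ((λ e → p≢0 (threshold-≡s0 _ e)) , threshold-bot _ n≡0)

    -- Interpolation is what lets a disjunction or an existential pass the
    -- hypothesis x ≪ y on to the disjunct or witness that covers y.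
    eval-threshold-s1 : ∀ {n} (ρ : Vec (U A) n) φ {y} → x ≪ y → y ⊑ eval π ρ φ →
      eval thresholdInterp ρ φ ≡ s1
    eval-threshold-s1 ρ (eq i j) x≪y y⊑ with (A ≟ lookup ρ i) (lookup ρ j)
    ... | yes _ = refl
    ... | no _  = ⊥-elim (≪⇒⋢bot x≪y y⊑)
    eval-threshold-s1 ρ (neq i j) x≪y y⊑ with (A ≟ lookup ρ i) (lookup ρ j)
    ... | yes _ = ⊥-elim (≪⇒⋢bot x≪y y⊑)
    ... | no _  = refl
    eval-threshold-s1 ρ (pos R xs) x≪y y⊑ =
      threshold-s1 _ (λ e → ≪⇒⋢bot x≪y (subst (_ ⊑_) e y⊑)) (⊑-trans (≪⇒⊑ x≪y) y⊑)
    eval-threshold-s1 ρ (neg R xs) x≪y y⊑ =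
      threshold-s1 _ (λ e → ≪⇒⋢bot x≪y (subst (_ ⊑_) e y⊑)) (⊑-trans (≪⇒⊑ x≪y) y⊑)
    eval-threshold-s1 ρ (or φ ψ) x≪y y⊑ with ≪-interpolate x≪y
    ... | z , x≪z , z≪y with ≪-family z≪y y⊑
    ...   | true  , z⊑ = attainedSup-s1 (max₃-attained _ _) true (eval-threshold-s1 ρ φ x≪z z⊑)
    ...   | false , z⊑ = attainedSup-s1 (max₃-attained _ _) false (eval-threshold-s1 ρ ψ x≪z z⊑)
    eval-threshold-s1 ρ (and φ ψ) x≪y y⊑ = attainedInf-s1 (min₃-attained _ _) λ
      { true  → eval-threshold-s1 ρ φ x≪y (⊑-trans y⊑ (⋀-lower Bool _ true))
      ; false → eval-threshold-s1 ρ ψ x≪y (⊑-trans y⊑ (⋀-lower Bool _ false)) }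
    eval-threshold-s1 ρ (ex φ) x≪y y⊑ with ≪-interpolate x≪y
    ... | z , x≪z , z≪y with ≪-family z≪y y⊑
    ...   | a , z⊑ = attainedSup-s1 (sup₃-attained _ _) a (eval-threshold-s1 (a ∷ ρ) φ x≪z z⊑)
    eval-threshold-s1 ρ (all φ) x≪y y⊑ = attainedInf-s1 (inf₃-attained _ _) λ a →
      eval-threshold-s1 (a ∷ ρ) φ x≪y (⊑-trans y⊑ (⋀-lower _ _ a))

    eval-threshold-≡s1 : ∀ {n} (ρ : Vec (U A) n) φ → eval thresholdInterp ρ φ ≡ s1 →
      x ⊑ eval π ρ φ
    eval-threshold-≡s1 ρ (eq i j) _ with (A ≟ lookup ρ i) (lookup ρ j)
    eval-threshold-≡s1 ρ (eq i j) _  | yes _ = top-greatest x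
    eval-threshold-≡s1 ρ (eq i j) () | no _
    eval-threshold-≡s1 ρ (neq i j) _ with (A ≟ lookup ρ i) (lookup ρ j)
    eval-threshold-≡s1 ρ (neq i j) () | yes _
    eval-threshold-≡s1 ρ (neq i j) _  | no _ = top-greatest x
    eval-threshold-≡s1 ρ (pos R xs) e = threshold-≡s1 _ e
    eval-threshold-≡s1 ρ (neg R xs) e = threshold-≡s1 _ e
    eval-threshold-≡s1 ρ (or φ ψ) e with attainedSup-≡s1 (max₃-attained _ _) e
    ... | true  , e′ = ⊑-trans (eval-threshold-≡s1 ρ φ e′) (⋁-upper Bool _ true)
    ... | false , e′ = ⊑-trans (eval-threshold-≡s1 ρ ψ e′) (⋁-upper Bool _ false)
    eval-threshold-≡s1 ρ (and φ ψ) e = ⋀-greatest Bool _ x λ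
      { true  → eval-threshold-≡s1 ρ φ (attainedInf-≡s1 (min₃-attained _ _) e true)
      ; false → eval-threshold-≡s1 ρ ψ (attainedInf-≡s1 (min₃-attained _ _) e false) }
    eval-threshold-≡s1 ρ (ex φ) e with attainedSup-≡s1 (sup₃-attained _ _) e
    ... | a , e′ = ⊑-trans (eval-threshold-≡s1 (a ∷ ρ) φ e′) (⋁-upper _ _ a)
    eval-threshold-≡s1 ρ (all φ) e = ⋀-greatest _ _ x λ a →
      eval-threshold-≡s1 (a ∷ ρ) φ (attainedInf-≡s1 (inf₃-attained _ _) e a)

    evalSet-threshold-s1 : ∀ Φ {y} → x ≪ y → y ⊑ evalSet π Φ → evalSet thresholdInterp Φ ≡ s1
    evalSet-threshold-s1 Φ x≪y y⊑ = attainedInf-s1 (inf₃-attained _ _) λ (φ , φ∈Φ) →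
      eval-threshold-s1 [] φ x≪y (⊑-trans y⊑ (⋀-lower _ _ (φ , φ∈Φ)))

    evalSet-threshold-≡s1 : ∀ Φ → evalSet thresholdInterp Φ ≡ s1 → x ⊑ evalSet π Φ
    evalSet-threshold-≡s1 Φ e = ⋀-greatest _ _ x λ (φ , φ∈Φ) →
      eval-threshold-≡s1 [] φ (attainedInf-≡s1 (inf₃-attained _ _) e (φ , φ∈Φ))

OneEntails : {σ : Signature} → EvalOps → SentenceSet σ → SentenceSet σ → Set₁
OneEntails {σ} S Φ Ψ = ∀ (A : Universe) (π : Interp σ S A) → ModelDefining π →
  evalSet π Φ ≡ EvalOps.𝟙 S → evalSet π Ψ ≡ EvalOps.𝟙 S

oneEntails⇒entails : ∀ (lem : ExcludedMiddle) (L : LatticeSemiring) {σ} {Φ Ψ : SentenceSet σ} →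
  OneEntails (S₃ lem) Φ Ψ → Entails (LatticeSemiring.ops L) Φ Ψ
oneEntails⇒entails lem L {Φ = Φ} {Ψ} oneEntails A π md =
  ⊑⇒natLeq (⊑-trans (⊑-⋁approximant a) (⋁-least _ _ _ approximant⊑evalΨ))
  where
  open LatticeSemiring L
  open LatticeProperties L
  open TotallyBelow lem L
  a : Carrier
  a = evalSet π Φ

  approximant⊑evalΨ : ∀ φ → approximant a φ ⊑ evalSet π Ψ
  approximant⊑evalΨ φ = evalSet-threshold-≡s1 π Ψ
    (oneEntails A (thresholdInterp π) (thresholdInterp-modelDefining π md)
      (evalSet-threshold-s1 π Φ (approximant-≪ a φ) ⊑-refl))
    where open Threshold lem L (approximant a φ)

module Embedding (lem : ExcludedMiddle) (L : LatticeSemiring) where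
  open LatticeSemiring L
  open LatticeProperties L
  open S₃Lattice lem

  module _ (e : Carrier) (e≢bot : e ≢ bot) (e≢top : e ≢ top) where

    embed : S3 → Carrier
    embed s0 = bot
    embed sε = e
    embed s1 = top

    embed-mono : ∀ {a b} → a ≤₃ b → embed a ⊑ embed b
    embed-mono s0≤   = bot-least _
    embed-mono ≤s1   = top-greatest _
    embed-mono sε≤sε = ⊑-refl

    embed-≢bot : ∀ a → a ≢ s0 → embed a ≢ bot
    embed-≢bot s0 a≢s0 = ⊥-elim (a≢s0 refl)
    embed-≢bot sε _    = e≢bot
    embed-≢bot s1 _    = λ top≡bot → nontrivial (sym top≡bot)

    embed-≡top : ∀ a → embed a ≡ top → a ≡ s1
    embed-≡top s0 bot≡top = ⊥-elim (nontrivial bot≡top)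
    embed-≡top sε e≡top   = ⊥-elim (e≢top e≡top)
    embed-≡top s1 _       = refl

    module _ {I : Set} {f : I → S3} {h : I → Carrier} (h≡embed∘f : ∀ i → h i ≡ embed (f i)) where

      ⋁-embed : ∀ {s} → AttainedSup f s → ⋁ I h ≡ embed s
      ⋁-embed {s} (ub , attained) = ⊑-antisym
        (⋁-least I h _ (λ i → subst (_⊑ embed s) (sym (h≡embed∘f i)) (embed-mono (ub i))))
        (lower attained)
        where
        lower : s ≡ s0 ⊎ Σ I (λ i → f i ≡ s) → embed s ⊑ ⋁ I h
        lower (inj₁ refl)       = bot-least _
        lower (inj₂ (i , refl)) = subst (_⊑ ⋁ I h) (h≡embed∘f i) (⋁-upper I h i)

      ⋀-embed : ∀ {s} → AttainedInf f s → ⋀ I h ≡ embed s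
      ⋀-embed {s} (lb , attained) = ⊑-antisym
        (upper attained)
        (⋀-greatest I h _ (λ i → subst (embed s ⊑_) (sym (h≡embed∘f i)) (embed-mono (lb i))))
        where
        upper : s ≡ s1 ⊎ Σ I (λ i → f i ≡ s) → ⋀ I h ⊑ embed s
        upper (inj₁ refl)       = top-greatest _
        upper (inj₂ (i , refl)) = subst (⋀ I h ⊑_) (h≡embed∘f i) (⋀-lower I h i)

    module _ {σ : Signature} {A : Universe} (π : Interp σ (S₃ lem) A) where

      embedInterp : Interp σ ops A
      embedInterp = record { πpos = λ R ā → embed (πpos π R ā)
                           ; πneg = λ R ā → embed (πneg π R ā) }

      embedInterp-modelDefining : ModelDefining π → ModelDefining embedInterp
      embedInterp-modelDefining md R ā with md R ā
      ... | inj₁ (p≡0 , n≢0) = inj₁ (cong embed p≡0 , embed-≢bot _ n≢0)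
      ... | inj₂ (p≢0 , n≡0) = inj₂ (embed-≢bot _ p≢0 , cong embed n≡0)

      eval-embed : ∀ {n} (ρ : Vec (U A) n) φ → eval embedInterp ρ φ ≡ embed (eval π ρ φ)
      eval-embed ρ (eq i j) with (A ≟ lookup ρ i) (lookup ρ j)
      ... | yes _ = refl
      ... | no _  = refl
      eval-embed ρ (neq i j) with (A ≟ lookup ρ i) (lookup ρ j)
      ... | yes _ = refl
      ... | no _  = refl
      eval-embed ρ (pos R xs) = refl
      eval-embed ρ (neg R xs) = refl
      eval-embed ρ (or φ ψ) =
        ⋁-embed (λ { true → eval-embed ρ φ ; false → eval-embed ρ ψ }) (max₃-attained (eval π ρ φ) (eval π ρ ψ))
      eval-embed ρ (and φ ψ) =
        ⋀-embed (λ { true → eval-embed ρ φ ; false → eval-embed ρ ψ }) (min₃-attained (eval π ρ φ) (eval π ρ ψ))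
      eval-embed ρ (ex φ)  = ⋁-embed (λ a → eval-embed (a ∷ ρ) φ) (sup₃-attained _ _)
      eval-embed ρ (all φ) = ⋀-embed (λ a → eval-embed (a ∷ ρ) φ) (inf₃-attained _ _)

      evalSet-embed : ∀ Φ → evalSet embedInterp Φ ≡ embed (evalSet π Φ)
      evalSet-embed Φ = ⋀-embed (λ (φ , _) → eval-embed [] φ) (inf₃-attained _ _)

    embed-entails⇒oneEntails : ∀ {σ} {Φ Ψ : SentenceSet σ} → Entails ops Φ Ψ → OneEntails (S₃ lem) Φ Ψ
    embed-entails⇒oneEntails {Φ = Φ} {Ψ} entails A π md evalΦ≡s1 =
      embed-≡top _ (trans (sym (evalSet-embed π Ψ)) (natLeq-top top≤evalΨ))
      where
      top≤evalΨ : NatLeq ops top (evalSet (embedInterp π) Ψ)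
      top≤evalΨ = subst (λ t → NatLeq ops t (evalSet (embedInterp π) Ψ))
                        (trans (evalSet-embed π Φ) (cong embed evalΦ≡s1))
                        (entails A (embedInterp π) (embedInterp-modelDefining π md))

entails⇒oneEntails : ∀ (lem : ExcludedMiddle) (L : LatticeSemiring) {σ} {Φ Ψ : SentenceSet σ} →
  ¬ IsoToBool L → Entails (LatticeSemiring.ops L) Φ Ψ → OneEntails (S₃ lem) Φ Ψ
entails⇒oneEntails lem L ¬iso =
  let e , e≢bot , e≢top = LatticeProperties.¬IsoToBool⇒thirdElement L lem ¬iso
  in Embedding.embed-entails⇒oneEntails lem L e e≢bot e≢top

mainTheorem14 : (lem : ExcludedMiddle) (σ : Signature) (Φ Ψ : SentenceSet σ) →
    let c1 = ∀ (L : LatticeSemiring) → ¬ IsoToBool L → Entails (LatticeSemiring.ops L) Φ Ψ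
        c2 = Σ LatticeSemiring (λ L → ¬ IsoToBool L × Entails (LatticeSemiring.ops L) Φ Ψ)
        c3 = ∀ (A : Universe) (π : Interp σ (S₃ lem) A) → ModelDefining π →
               evalSet π Φ ≡ s1 → evalSet π Ψ ≡ s1
    in ((c1 → c2) × (c2 → c1)) × ((c2 → c3) × (c3 → c2))
mainTheorem14 lem σ Φ Ψ =
  ( (λ c1 → L₃ , L₃-¬IsoToBool , c1 L₃ L₃-¬IsoToBool)
  , (λ (L , ¬iso , entails) L′ _ → oneEntails⇒entails lem L′ (entails⇒oneEntails lem L ¬iso entails)) )
  , ( (λ (L , ¬iso , entails) → entails⇒oneEntails lem L ¬iso entails)
    , (λ c3 → L₃ , L₃-¬IsoToBool , oneEntails⇒entails lem L₃ c3) )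
  where open S₃Lattice lem
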